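{- Let $w_1,w_2,w_3$ be indexed containers over $I_1,I_2,I_3$, and let $(R,\rho):w_1\multimap w_2$ and $(S,\sigma):w_2\multimap w_3$ be linear simulations. Let $i_k:I_k$, $r:R(i_1,i_2)$ and $s:S(i_2,i_3)$, so that $\langle i_2,\langle r,s\rangle\rangle:(S\circ R)(i_1,i_3)$. Then for every $T:i_1\in\nu_{w_1^\bot}$, $\mathrm{eval}_{S\circ R}\,i_1\,i_3\,\langle i_2,\langle r,s\rangle\rangle\,T$ is bisimilar to $\mathrm{eval}_S\,i_2\,i_3\,s\,\big(\mathrm{eval}_R\,i_1\,i_2\,r\,T\big)$.
   Context: Indexed container $w=\langle A,D,n\rangle$ over $I$, with $i[a/d]=n(i,a,d)$ and extension $i\in[\![w]\!](X)=\sum_{a}\prod_{d}X(i[a/d])$. Dual $w^\bot$: $A^\bot(i)=\prod_a D(i,a)$, $D^\bot(i,f)=A(i)$, $n^\bot(i,f,a)=i[a/f\,a]$. Coinductive $\nu_v$: $\nu\mathrm{elim}:\nu_v\subseteq[\![v]\!](\nu_v)$, $\nu\mathrm{intro}\,c:X\subseteq\nu_v$ for $c:X\subseteq[\![v]\!](X)$, with $\nu\mathrm{elim}(\nu\mathrm{intro}\,c\,i\,x)=[\![v]\!]_{\nu\mathrm{intro}\,c}\,i\,(c\,i\,x)$, where $[\![v]\!]_h\langle a,k\rangle=\langle a,\lambda d.h(k\,d)\rangle$. Linear simulation $(R,\rho):w_1\multimap w_2$: $\rho:\prod R(i_1,i_2)\to\prod_{a_2}\sum_{a_1}\prod_{d_1}\sum_{d_2}R(i_1[a_1/d_1],i_2[a_2/d_2])$.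 Composite $S\circ R$ has relation $\sum_{i_2}R(i_1,i_2)\times S(i_2,i_3)$ and proof defined as follows. Given $\langle i_2,\langle r,s\rangle\rangle$ and $a_3$, let $\sigma\,s\,a_3=\langle a_2,h\rangle$ and $\rho\,r\,a_2=\langle a_1,k\rangle$, and answer $a_1$. Given $d_1$, let $k\,d_1=\langle d_2,r'\rangle$ and $h\,d_2=\langle d_3,s'\rangle$, and return $d_3$ and $\langle i_2[a_2/d_2],\langle r',s'\rangle\rangle$. Evaluation: $\mathrm{eval}_R\,i_1\,i_2\,r\,T=\nu\mathrm{intro}\,c\,i_2\,\langle i_1,r,T\rangle$ where $X(i_2)=\sum_{i_1}R(i_1,i_2)\times(i_1\in\nu_{w_1^\bot})$. Given $\langle i_1,r,T\rangle$, the coalgebra $c$ maps each $a_2$ to the response $d_2$ and the continuation $\langle i_1[a_1/d_1],r',U\,a_1\rangle$, where $\rho\,r\,a_2=\langle a_1,h\rangle$, $\nu\mathrm{elim}\,T=\langle g,U\rangle$, $d_1=g\,a_1$ and $h\,d_1=\langle d_2,r'\rangle$. Bisimilarity on $i_0\in\nu_v$: there is an indexed family of relations $Q_i$ on $i\in\nu_v$ relating the two elements, such that whenever $Q_i(S_1,S_2)$ holds with $\nu\mathrm{elim}\,S_k=\langle a_k,f_k\rangle$, we have $a_1\equiv a_2$ and $Q_{i[a_1/d]}(f_1\,d,f_2\,d)$ for all $d$ (after transport). -}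

module Defs where

open import Data.Product using (Σ; _×_; _,_; proj₁; proj₂)
open import Relation.Binary.PropositionalEquality using (_≡_)

-- Indexed containers  w = ⟨A, D, n⟩  over I, with  i[a/d] = n i a d
record IC (I : Set) : Set₁ where
  constructor ⟨_,_,_⟩
  field
    A : I → Set
    D : (i : I) → A i → Set
    n : (i : I) (a : A i) → D i a → I
open IC public

_⊆_ : {I : Set} → (I → Set) → (I → Set) → Set
X ⊆ Y = ∀ i → X i → Y i

⟦_⟧ : {I : Set} → IC I → (I → Set) → I → Set
⟦ w ⟧ X i = Σ (A w i) λ a → (d : D w i a) → X (n w i a d)

⟦_⟧₁ : {I : Set} (v : IC I) {X Y : I → Set} → X ⊆ Y → ⟦ v ⟧ X ⊆ ⟦ v ⟧ Y
⟦ v ⟧₁ h i (a , k) = a , λ d → h _ (k d)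

_⊥ : {I : Set} → IC I → IC I
w ⊥ = record
  { A = λ i → (a : A w i) → D w i a
  ; D = λ i f → A w i
  ; n = λ i f a → n w i a (f a)
  }

record Coinduction : Set₁ where
  field
    ν      : {I : Set} → IC I → I → Set
    νelim  : {I : Set} {v : IC I} → ν v ⊆ ⟦ v ⟧ (ν v)
    νintro : {I : Set} {v : IC I} {X : I → Set} → X ⊆ ⟦ v ⟧ X → X ⊆ ν v
    νβ     : {I : Set} {v : IC I} {X : I → Set} (c : X ⊆ ⟦ v ⟧ X) (i : I) (x : X i) →
             νelim i (νintro c i x) ≡ ⟦ v ⟧₁ (νintro c) i (c i x)
open Coinduction public

record _⊸_ {I₁ I₂ : Set} (w₁ : IC I₁) (w₂ : IC I₂) : Set₁ where
  field
    Rel : I₁ → I₂ → Set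
    sim : ∀ {i₁ i₂} → Rel i₁ i₂ →
          (a₂ : A w₂ i₂) → Σ (A w₁ i₁) λ a₁ →
          (d₁ : D w₁ i₁ a₁) → Σ (D w₂ i₂ a₂) λ d₂ →
          Rel (n w₁ i₁ a₁ d₁) (n w₂ i₂ a₂ d₂)
open _⊸_ public

_∘ₛ_ : {I₁ I₂ I₃ : Set} {w₁ : IC I₁} {w₂ : IC I₂} {w₃ : IC I₃} →
       w₂ ⊸ w₃ → w₁ ⊸ w₂ → w₁ ⊸ w₃
_∘ₛ_ {I₂ = I₂} {w₂ = w₂} S R = record
  { Rel = λ i₁ i₃ → Σ I₂ λ i₂ → Rel R i₁ i₂ × Rel S i₂ i₃
  ; sim = λ { {i₁} {i₃} (i₂ , r , s) a₃ →
      let a₂ = proj₁ (sim S s a₃)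
          h  = proj₂ (sim S s a₃)
          a₁ = proj₁ (sim R r a₂)
          k  = proj₂ (sim R r a₂)
      in a₁ , λ d₁ →
        let d₂ = proj₁ (k d₁)
            r' = proj₂ (k d₁)
            d₃ = proj₁ (h d₂)
            s' = proj₂ (h d₂)
        in d₃ , (n w₂ i₂ a₂ d₂ , r' , s') }
  }

module WithNu (C : Coinduction) where
  open Coinduction C using () renaming (ν to ν'; νelim to νelim'; νintro to νintro')

  module _ {I₁ I₂ : Set} {w₁ : IC I₁} {w₂ : IC I₂} (R : w₁ ⊸ w₂) where

    EvalState : I₂ → Set
    EvalState i₂ = Σ I₁ λ i₁ → Rel R i₁ i₂ × ν' (w₁ ⊥) i₁

    evalCoalg : EvalState ⊆ ⟦ w₂ ⊥ ⟧ EvalState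
    evalCoalg i₂ (i₁ , r , T) =
      (λ a₂ → proj₁ (proj₂ (sim R r a₂) (proj₁ (νelim' i₁ T) (proj₁ (sim R r a₂))))) ,
      λ a₂ → let a₁ = proj₁ (sim R r a₂)
                 h  = proj₂ (sim R r a₂)
                 g  = proj₁ (νelim' i₁ T)
                 U  = proj₂ (νelim' i₁ T)
                 d₁ = g a₁
             in n w₁ i₁ a₁ d₁ , proj₂ (h d₁) , U a₁

    eval : (i₁ : I₁) (i₂ : I₂) → Rel R i₁ i₂ → ν' (w₁ ⊥) i₁ → ν' (w₂ ⊥) i₂
    eval i₁ i₂ r T = νintro' evalCoalg i₂ (i₁ , r , T)

  data Step {I : Set} (v : IC I) (Q : (i : I) → ν' v i → ν' v i → Set) (i : I) :
            ⟦ v ⟧ (ν' v) i → ⟦ v ⟧ (ν' v) i → Set where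
    step : (a : A v i) (f₁ f₂ : (d : D v i a) → ν' v (n v i a d)) →
           ((d : D v i a) → Q (n v i a d) (f₁ d) (f₂ d)) →
           Step v Q i (a , f₁) (a , f₂)

  IsBisimulation : {I : Set} (v : IC I) → ((i : I) → ν' v i → ν' v i → Set) → Set
  IsBisimulation v Q = ∀ i S₁ S₂ → Q i S₁ S₂ → Step v Q i (νelim' i S₁) (νelim' i S₂)

  Bisimilar : {I : Set} (v : IC I) (i₀ : I) → ν' v i₀ → ν' v i₀ → Set₁
  Bisimilar {I} v i₀ S₁ S₂ =
    Σ ((i : I) → ν' v i → ν' v i → Set) λ Q → IsBisimulation v Q × Q i₀ S₁ S₂

-- Both sides are images of the state ⟨i₁ , ⟨i₂ , r , s⟩ , T⟩ under coalgebra morphisms out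
-- of the evaluation coalgebra of S ∘ R: the left one is its anamorphism, and the right one,
-- eval S ∘ eval R, is a morphism because unfolding it twice performs exactly the composite
-- simulation step.  Two coalgebra morphisms into ν agree up to bisimilarity, the bisimulation
-- relating the two images of each state.
module Submission where

open import Defs
open import Data.Product using (Σ; _×_; _,_; proj₁; proj₂)
open import Relation.Binary.PropositionalEquality using (_≡_; refl; cong; module ≡-Reasoning)

module _ (C : Coinduction) where
  open WithNu C

  IsCoalgebraMorphism : {I : Set} {v : IC I} {X : I → Set} →
                        X ⊆ ⟦ v ⟧ X → X ⊆ ν C v → Set
  IsCoalgebraMorphism {v = v} c f = ∀ i x → νelim C i (f i x) ≡ ⟦ v ⟧₁ f i (c i x)

  νintro-isCoalgebraMorphism : {I : Set} {v : IC I} {X : I → Set}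
                               (c : X ⊆ ⟦ v ⟧ X) → IsCoalgebraMorphism c (νintro C c)
  νintro-isCoalgebraMorphism = νβ C

  module _ {I : Set} {v : IC I} {X : I → Set} (c : X ⊆ ⟦ v ⟧ X) (f g : X ⊆ ν C v) where

    CommonPreimage : (i : I) → ν C v i → ν C v i → Set
    CommonPreimage i S₁ S₂ = Σ (X i) λ x → S₁ ≡ f i x × S₂ ≡ g i x

    commonPreimage-isBisimulation : IsCoalgebraMorphism c f → IsCoalgebraMorphism c g →
                                    IsBisimulation v CommonPreimage
    commonPreimage-isBisimulation f-mor g-mor i _ _ (x , refl , refl)
      rewrite f-mor i x | g-mor i x with c i x
    ... | a , k = step a _ _ λ d → k d , refl , refl

    coalgebraMorphisms-bisimilar : IsCoalgebraMorphism c f → IsCoalgebraMorphism c g →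
                                   ∀ i x → Bisimilar v i (f i x) (g i x)
    coalgebraMorphisms-bisimilar f-mor g-mor i x =
      CommonPreimage , commonPreimage-isBisimulation f-mor g-mor , x , refl , refl

  module _ {I₁ I₂ : Set} {w₁ : IC I₁} {w₂ : IC I₂} (R : w₁ ⊸ w₂) where

    evalStep : ∀ {i₁ i₂} → Rel R i₁ i₂ →
               ⟦ w₁ ⊥ ⟧ (ν C (w₁ ⊥)) i₁ → ⟦ w₂ ⊥ ⟧ (ν C (w₂ ⊥)) i₂
    evalStep r (g , U) =
      (λ a₂ → proj₁ (proj₂ (sim R r a₂) (g (proj₁ (sim R r a₂))))) ,
      λ a₂ → let a₁ = proj₁ (sim R r a₂) in
             eval R _ _ (proj₂ (proj₂ (sim R r a₂) (g a₁))) (U a₁)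

    νelim-eval : ∀ {i₁ i₂} (r : Rel R i₁ i₂) (T : ν C (w₁ ⊥) i₁) →
                 νelim C i₂ (eval R i₁ i₂ r T) ≡ evalStep r (νelim C i₁ T)
    νelim-eval {i₁} {i₂} r T = νβ C (evalCoalg R) i₂ (i₁ , r , T)

  module _ {I₁ I₂ I₃ : Set} {w₁ : IC I₁} {w₂ : IC I₂} {w₃ : IC I₃}
           (R : w₁ ⊸ w₂) (S : w₂ ⊸ w₃) where

    evalThenEval : EvalState (S ∘ₛ R) ⊆ ν C (w₃ ⊥)
    evalThenEval i₃ (i₁ , (i₂ , r , s) , T) = eval S i₂ i₃ s (eval R i₁ i₂ r T)

    evalThenEval-isCoalgebraMorphism : IsCoalgebraMorphism (evalCoalg (S ∘ₛ R)) evalThenEval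
    evalThenEval-isCoalgebraMorphism i₃ x@(i₁ , (i₂ , r , s) , T) = begin
      νelim C i₃ (eval S i₂ i₃ s (eval R i₁ i₂ r T))     ≡⟨ νelim-eval S s (eval R i₁ i₂ r T) ⟩
      evalStep S s (νelim C i₂ (eval R i₁ i₂ r T))       ≡⟨ cong (evalStep S s) (νelim-eval R r T) ⟩
      evalStep S s (evalStep R r (νelim C i₁ T))         ≡⟨⟩
      ⟦ w₃ ⊥ ⟧₁ evalThenEval i₃ (evalCoalg (S ∘ₛ R) i₃ x) ∎
      where open ≡-Reasoning

lemma4p5 : (C : Coinduction) →
           {I₁ I₂ I₃ : Set} {w₁ : IC I₁} {w₂ : IC I₂} {w₃ : IC I₃} →
           (R : w₁ ⊸ w₂) (S : w₂ ⊸ w₃) →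
           (i₁ : I₁) (i₂ : I₂) (i₃ : I₃) (r : Rel R i₁ i₂) (s : Rel S i₂ i₃) →
           (T : ν C (w₁ ⊥) i₁) →
           WithNu.Bisimilar C (w₃ ⊥) i₃
             (WithNu.eval C (S ∘ₛ R) i₁ i₃ (i₂ , r , s) T)
             (WithNu.eval C S i₂ i₃ s (WithNu.eval C R i₁ i₂ r T))
lemma4p5 C R S i₁ i₂ i₃ r s T =
  coalgebraMorphisms-bisimilar C (WithNu.evalCoalg C (S ∘ₛ R))
    (νintro C (WithNu.evalCoalg C (S ∘ₛ R))) (evalThenEval C R S)
    (νintro-isCoalgebraMorphism C _) (evalThenEval-isCoalgebraMorphism C R S)
    i₃ (i₁ , (i₂ , r , s) , T)
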